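{- For every integer $n\ge1$, \[ \sum_{k=1}^{n}2^{k-1}\omega(n-k)=\sum_{\substack{m+k=n\\ m\ge 1,\ k\ge 0}}c_\psi(m)\sum_{j\ge0}\omega(k-jm), \] where $c_\psi(m)$ is the number of relatively prime compositions of $m$, i.e. ordered sequences $(a_1,\dots,a_r)$ of positive integers with $a_1+\cdots+a_r=m$ and $\gcd(a_1,\dots,a_r)=1$.
   Context: For integers $m$, $\omega(m)=1$ if $m=0$; $\omega(m)=(-1)^i$ if $m=\frac{3i^2\pm i}{2}$ for some positive integer $i$; $\omega(m)=0$ otherwise (in particular for $m<0$). -}

module Defs where

open import Data.Nat as ℕ using (ℕ; zero; suc; _∸_)
open import Data.Nat.GCD using (gcd)
open import Data.Integer as ℤ using (ℤ; +_; -[1+_]; _+_; _*_; _-_; 0ℤ; 1ℤ; -1ℤ)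
open import Data.List using (List; []; _∷_; foldr; map; concatMap; length; filter; upTo; applyUpTo)
open import Data.Bool using (Bool; true; false; if_then_else_)
open import Relation.Nullary using (does)

sign : ℕ → ℤ
sign zero = 1ℤ
sign (suc i) = ℤ.- sign i

-- Any such i satisfies i ≤ m, so it suffices to search i ∈ {1,…,m}.
-- (The generalized pentagonal numbers (3i²±i)/2, i ≥ 1, are pairwise distinct, so the
-- first hit is the unique one.)
isPent : ℕ → ℕ → Bool
isPent m i = does ((2 ℕ.* m) ℕ.≟ (3 ℕ.* i ℕ.* i ℕ.+ i))
             Data.Bool.∨ does ((2 ℕ.* m) ℕ.≟ (3 ℕ.* i ℕ.* i ∸ i))

searchPent : ℕ → ℕ → ℤ
searchPent m zero = 0ℤ
searchPent m (suc b) = if isPent m (suc b) then sign (suc b) else searchPent m b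

ωℕ : ℕ → ℤ
ωℕ zero = 1ℤ
ωℕ (suc m) = searchPent (suc m) (suc m)

ω : ℤ → ℤ
ω (+ m) = ωℕ m
ω -[1+ m ] = 0ℤ

-- Σ_{i = a}^{b} f i  (empty if b < a), over ℤ
sumℤ : List ℤ → ℤ
sumℤ = foldr _+_ 0ℤ

Σ[_≤_≤_] : ℕ → ℕ → (ℕ → ℤ) → ℤ
Σ[ a ≤ b ≤ f ] = sumℤ (map (λ t → f (a ℕ.+ t)) (upTo (suc b ∸ a)))

-- All compositions of m: ordered lists of positive integers summing to m.
-- compsF fuel m enumerates them by choosing the first part a ∈ {1,…,m};
-- fuel ≥ m guarantees completeness.
compsF : ℕ → ℕ → List (List ℕ)
compsF _ zero = [] ∷ []
compsF zero (suc m) = []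
compsF (suc fuel) (suc m) =
  concatMap (λ a → map (suc a ∷_) (compsF fuel (m ∸ a))) (upTo (suc m))

compositions : ℕ → List (List ℕ)
compositions m = compsF m m

gcdList : List ℕ → ℕ
gcdList = foldr gcd 0

cψ : ℕ → ℕ
cψ m = length (filter (λ c → gcdList c ℕ.≟ 1) (compositions m))

-- Sorting the 2^(k-1) compositions of k by the gcd d of their parts, and dividing every part
-- by d, gives 2^(k-1) = Σ_{d ∣ k} cψ(k/d).  Substituting this on the left and summing first over
-- the cofactor m = k/d turns the left-hand side into Σ_m cψ(m) Σ_{d ≥ 1} ω(n - dm), which is the
-- right-hand side.  Nothing about ω is used except that it vanishes on negative integers.
module Submission where

open import Defs
open import Data.Nat as ℕ using (ℕ; suc; _∸_)
open import Data.Integer as ℤ using (ℤ; +_; _-_; _*_)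
open import Relation.Binary.PropositionalEquality using (_≡_)

open import Algebra.Core using (Op₂)
open import Algebra.Structures using (IsCommutativeMonoid)
open import Data.Bool using (true; false; if_then_else_)
open import Data.Integer using (0ℤ; _⊖_)
import Data.Integer.Properties as ℤₚ
open import Data.List using (List; []; _∷_; _++_; map; concatMap; applyUpTo; upTo; filter; length)
open import Data.List.Membership.Propositional using (_∈_; find)
open import Data.List.Membership.Propositional.Properties using (∈-concatMap⁻; ∈-map⁻; ∈-upTo⁻)
open import Data.List.Properties
  using (length-++; length-map; filter-++; filter-none; filter-≐; concatMap-cong)
import Data.List.Relation.Unary.All as All
open import Data.List.Relation.Unary.Any using (here; there)
open import Data.Nat using (zero; _+_; _≤_; _<_; z≤n; s≤s; NonZero; >-nonZero)
open import Data.Nat.Divisibility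
  using (_∣_; _∤_; >⇒∤; ∣m+n∣m⇒∣n; ∣m∣n⇒∣m+n; ∣-refl; ∣-trans; n∣m*n; ∣⇒≤; 0∣⇒≡0)
open import Data.Nat.GCD
  using (gcd; gcd[m,n]∣m; gcd[m,n]∣n; gcd-greatest; gcd-assoc; gcd-identityˡ; gcd-identityʳ
        ; c*gcd[m,n]≡gcd[cm,cn])
open import Data.Nat.Induction using (<-rec)
open import Data.Nat.ListAction using (sum)
import Data.Nat.Properties as ℕₚ
open import Data.Product using (_×_; _,_)
open import Function using (_∘_)
open import Relation.Nullary using (yes; no; contradiction)
open import Relation.Binary.PropositionalEquality
  using (_≢_; refl; sym; trans; cong; cong₂; subst; module ≡-Reasoning)

module RangeSum {A : Set} {_∙_ : Op₂ A} {ε : A}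
                (isCommutativeMonoid : IsCommutativeMonoid _≡_ _∙_ ε) where

  open IsCommutativeMonoid isCommutativeMonoid using (assoc; comm; identityˡ; identityʳ)

  ∑ : ℕ → (ℕ → A) → A
  ∑ zero    f = ε
  ∑ (suc n) f = f 0 ∙ ∑ n (f ∘ suc)

  syntax ∑ n (λ i → f) = ∑[ i < n ] f

  ∑-cong : ∀ n {f g : ℕ → A} → (∀ i → i < n → f i ≡ g i) → ∑ n f ≡ ∑ n g
  ∑-cong zero    f≡g = refl
  ∑-cong (suc n) f≡g = cong₂ _∙_ (f≡g 0 (s≤s z≤n)) (∑-cong n (λ i i<n → f≡g (suc i) (s≤s i<n)))

  ∑-vanishing : ∀ n {f : ℕ → A} → (∀ i → i < n → f i ≡ ε) → ∑ n f ≡ ε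
  ∑-vanishing zero    f≡ε = refl
  ∑-vanishing (suc n) f≡ε =
    trans (cong₂ _∙_ (f≡ε 0 (s≤s z≤n)) (∑-vanishing n (λ i i<n → f≡ε (suc i) (s≤s i<n))))
          (identityˡ ε)

  ∑-split : ∀ m n (f : ℕ → A) → ∑ (m + n) f ≡ ∑ m f ∙ (∑[ i < n ] f (m + i))
  ∑-split zero    n f = sym (identityˡ _)
  ∑-split (suc m) n f = trans (cong (f 0 ∙_) (∑-split m n (f ∘ suc))) (sym (assoc _ _ _))

  ∑-snoc : ∀ n (f : ℕ → A) → ∑ (suc n) f ≡ ∑ n f ∙ f n
  ∑-snoc n f = begin
    ∑ (suc n) f               ≡⟨ cong (λ k → ∑ k f) (ℕₚ.+-comm 1 n) ⟩
    ∑ (n + 1) f               ≡⟨ ∑-split n 1 f ⟩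
    ∑ n f ∙ (f (n + 0) ∙ ε)   ≡⟨ cong (∑ n f ∙_) (trans (identityʳ _) (cong f (ℕₚ.+-identityʳ n))) ⟩
    ∑ n f ∙ f n               ∎
    where open ≡-Reasoning

  ∑-extend : ∀ {n m} {f : ℕ → A} → n ≤ m → (∀ i → n ≤ i → i < m → f i ≡ ε) → ∑ m f ≡ ∑ n f
  ∑-extend {n} {m} {f} n≤m tail≡ε = begin
    ∑ m f                              ≡⟨ cong (λ k → ∑ k f) (sym (ℕₚ.m+[n∸m]≡n n≤m)) ⟩
    ∑ (n + (m ∸ n)) f                  ≡⟨ ∑-split n (m ∸ n) f ⟩
    ∑ n f ∙ (∑[ i < m ∸ n ] f (n + i)) ≡⟨ cong (∑ n f ∙_) (∑-vanishing (m ∸ n) tail-vanishes) ⟩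
    ∑ n f ∙ ε                          ≡⟨ identityʳ _ ⟩
    ∑ n f                              ∎
    where
    open ≡-Reasoning
    tail-vanishes : ∀ i → i < m ∸ n → f (n + i) ≡ ε
    tail-vanishes i i<m∸n =
      tail≡ε (n + i) (ℕₚ.m≤m+n n i) (subst (n + i <_) (ℕₚ.m+[n∸m]≡n n≤m) (ℕₚ.+-monoʳ-< n i<m∸n))

  ∑-distrib : ∀ n (f g : ℕ → A) → ∑[ i < n ] (f i ∙ g i) ≡ ∑ n f ∙ ∑ n g
  ∑-distrib zero    f g = sym (identityˡ ε)
  ∑-distrib (suc n) f g = begin
    (f 0 ∙ g 0) ∙ (∑[ i < n ] (f (suc i) ∙ g (suc i)))
      ≡⟨ cong ((f 0 ∙ g 0) ∙_) (∑-distrib n (f ∘ suc) (g ∘ suc)) ⟩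
    (f 0 ∙ g 0) ∙ (∑ n (f ∘ suc) ∙ ∑ n (g ∘ suc))
      ≡⟨ interchange ⟩
    (f 0 ∙ ∑ n (f ∘ suc)) ∙ (g 0 ∙ ∑ n (g ∘ suc)) ∎
    where
    open ≡-Reasoning
    interchange : ∀ {a b c d} → (a ∙ b) ∙ (c ∙ d) ≡ (a ∙ c) ∙ (b ∙ d)
    interchange {a} {b} {c} {d} = begin
      (a ∙ b) ∙ (c ∙ d)   ≡⟨ assoc a b (c ∙ d) ⟩
      a ∙ (b ∙ (c ∙ d))   ≡⟨ cong (a ∙_) (sym (assoc b c d)) ⟩
      a ∙ ((b ∙ c) ∙ d)   ≡⟨ cong (λ x → a ∙ (x ∙ d)) (comm b c) ⟩
      a ∙ ((c ∙ b) ∙ d)   ≡⟨ cong (a ∙_) (assoc c b d) ⟩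
      a ∙ (c ∙ (b ∙ d))   ≡⟨ sym (assoc a c (b ∙ d)) ⟩
      (a ∙ c) ∙ (b ∙ d)   ∎

  ∑-comm : ∀ m n (f : ℕ → ℕ → A) → ∑[ i < m ] ∑[ j < n ] f i j ≡ ∑[ j < n ] ∑[ i < m ] f i j
  ∑-comm zero    n f = sym (∑-vanishing n (λ _ _ → refl))
  ∑-comm (suc m) n f = trans (cong (∑ n (f 0) ∙_) (∑-comm m n (f ∘ suc)))
                             (sym (∑-distrib n (f 0) (λ j → ∑[ i < m ] f (suc i) j)))

  ∑-multiples : ∀ M k .{{_ : NonZero k}} (F : ℕ → A) → (∀ N → k ∤ N → F N ≡ ε) →
                ∑[ t < M ℕ.* k ] F (suc t) ≡ ∑[ b < M ] F (suc b ℕ.* k)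
  ∑-multiples zero    k F F≡ε = refl
  ∑-multiples (suc M) k@(suc k′) F F≡ε = begin
    ∑[ t < k + M ℕ.* k ] F (suc t)
      ≡⟨ ∑-split k (M ℕ.* k) (F ∘ suc) ⟩
    (∑[ t < k ] F (suc t)) ∙ (∑[ t < M ℕ.* k ] F (suc (k + t)))
      ≡⟨ cong₂ _∙_ first-block rest ⟩
    F k ∙ (∑[ b < M ] F (k + suc b ℕ.* k))
      ≡⟨ cong (λ x → F x ∙ (∑[ b < M ] F (k + suc b ℕ.* k))) (sym (ℕₚ.*-identityˡ k)) ⟩
    ∑[ b < suc M ] F (suc b ℕ.* k) ∎
    where
    open ≡-Reasoning
    first-block : ∑[ t < k ] F (suc t) ≡ F k
    first-block = begin
      ∑[ t < k ] F (suc t)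
        ≡⟨ ∑-snoc k′ (F ∘ suc) ⟩
      (∑[ t < k′ ] F (suc t)) ∙ F k
        ≡⟨ cong (_∙ F k) (∑-vanishing k′ (λ t t<k′ → F≡ε (suc t) (>⇒∤ (s≤s t<k′)))) ⟩
      ε ∙ F k
        ≡⟨ identityˡ (F k) ⟩
      F k ∎
    rest : ∑[ t < M ℕ.* k ] F (suc (k + t)) ≡ ∑[ b < M ] F (k + suc b ℕ.* k)
    rest = trans (∑-cong (M ℕ.* k) (λ t _ → cong F (sym (ℕₚ.+-suc k t))))
                 (∑-multiples M k (λ N → F (k + N))
                   (λ N k∤N → F≡ε (k + N) (λ k∣k+N → k∤N (∣m+n∣m⇒∣n k∣k+N ∣-refl))))

  ∑-multiples-bounded : ∀ n k .{{_ : NonZero k}} (F : ℕ → A) →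
                        (∀ N → k ∤ N → F N ≡ ε) → (∀ N → n < N → F N ≡ ε) →
                        ∑[ t < n ] F (suc t) ≡ ∑[ b < n ] F (suc b ℕ.* k)
  ∑-multiples-bounded n k F F≡ε F-beyond =
    trans (sym (∑-extend (ℕₚ.m≤m*n n k) (λ t n≤t _ → F-beyond (suc t) (s≤s n≤t))))
          (∑-multiples n k F F≡ε)

module ℕ∑ = RangeSum ℕₚ.+-0-isCommutativeMonoid
module ℤ∑ = RangeSum ℤₚ.+-0-isCommutativeMonoid

δ : ℕ → ℕ → ℕ
δ m n = if m ℕ.≡ᵇ n then 1 else 0

∑-δ : ∀ {y} B → 1 ≤ y → y ≤ B → ℕ∑.∑[ v < B ] δ y (suc v) ≡ 1
∑-δ {suc zero}    (suc B) _ _         = cong suc (ℕ∑.∑-vanishing B (λ _ _ → refl))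
∑-δ {suc (suc y)} (suc B) _ (s≤s y<B) = ∑-δ B (s≤s z≤n) y<B

δ-refl : ∀ m → δ m m ≡ 1
δ-refl zero    = refl
δ-refl (suc m) = δ-refl m

δ-≢ : ∀ {m n} → m ≢ n → δ m n ≡ 0
δ-≢ {zero}  {zero}  m≢n = contradiction refl m≢n
δ-≢ {zero}  {suc n} _   = refl
δ-≢ {suc m} {zero}  _   = refl
δ-≢ {suc m} {suc n} m≢n = δ-≢ (m≢n ∘ cong suc)

δ-*ʳ : ∀ m n k .{{_ : NonZero k}} → δ (m ℕ.* k) (n ℕ.* k) ≡ δ m n
δ-*ʳ m n k with m ℕₚ.≟ n
... | yes refl = trans (δ-refl (m ℕ.* k)) (sym (δ-refl m))
... | no  m≢n  = trans (δ-≢ (m≢n ∘ ℕₚ.*-cancelʳ-≡ m n k)) (sym (δ-≢ m≢n))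

private
  variable
    A A′ : Set

count : (A → ℕ) → ℕ → List A → ℕ
count f v xs = length (filter (λ x → f x ℕₚ.≟ v) xs)

count-∷ : ∀ (f : A → ℕ) v x xs → count f v (x ∷ xs) ≡ δ (f x) v + count f v xs
count-∷ f v x xs with f x ℕ.≡ᵇ v
... | true  = refl
... | false = refl

count-++ : ∀ (f : A → ℕ) v xs ys → count f v (xs ++ ys) ≡ count f v xs + count f v ys
count-++ f v xs ys =
  trans (cong length (filter-++ (λ x → f x ℕₚ.≟ v) xs ys)) (length-++ (filter (λ x → f x ℕₚ.≟ v) xs))

count-concatMap : ∀ (f : A → ℕ) v (G : ℕ → List A) h n →
                  count f v (concatMap G (applyUpTo h n)) ≡ ℕ∑.∑[ i < n ] count f v (G (h i))
count-concatMap f v G h zero    = refl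
count-concatMap f v G h (suc n) =
  trans (count-++ f v (G (h 0)) (concatMap G (applyUpTo (h ∘ suc) n)))
        (cong (count f v (G (h 0)) ℕ.+_) (count-concatMap f v G (h ∘ suc) n))

length-concatMap : ∀ (G : ℕ → List A) h n →
                   length (concatMap G (applyUpTo h n)) ≡ ℕ∑.∑[ i < n ] length (G (h i))
length-concatMap G h zero    = refl
length-concatMap G h (suc n) =
  trans (length-++ (G (h 0))) (cong (length (G (h 0)) ℕ.+_) (length-concatMap G (h ∘ suc) n))

count-map : ∀ (f : A → ℕ) v (g : A′ → A) xs → count f v (map g xs) ≡ count (f ∘ g) v xs
count-map f v g []       = refl
count-map f v g (x ∷ xs) with f (g x) ℕ.≡ᵇ v
... | true  = cong suc (count-map f v g xs)
... | false = count-map f v g xs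

count-cong : ∀ {f f′ : A → ℕ} v xs → (∀ x → f x ≡ f′ x) → count f v xs ≡ count f′ v xs
count-cong {f = f} {f′} v xs f≡f′ = cong length (filter-≐ (λ x → f x ℕₚ.≟ v) (λ x → f′ x ℕₚ.≟ v)
  ((λ {x} → trans (sym (f≡f′ x))) , (λ {x} → trans (f≡f′ x))) xs)

count-none : ∀ (f : A → ℕ) v xs → (∀ {x} → x ∈ xs → f x ≢ v) → count f v xs ≡ 0
count-none f v xs miss = cong length (filter-none (λ x → f x ℕₚ.≟ v) (All.tabulate miss))

∑-count : ∀ (f : A → ℕ) B xs → (∀ {x} → x ∈ xs → 1 ≤ f x × f x ≤ B) →
          ℕ∑.∑[ v < B ] count f (suc v) xs ≡ length xs
∑-count f B []       _     = ℕ∑.∑-vanishing B (λ _ _ → refl)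
∑-count f B (x ∷ xs) range with 1≤fx , fx≤B ← range (here refl) = begin
  ℕ∑.∑[ v < B ] count f (suc v) (x ∷ xs)
    ≡⟨ ℕ∑.∑-cong B (λ v _ → count-∷ f (suc v) x xs) ⟩
  ℕ∑.∑[ v < B ] (δ (f x) (suc v) + count f (suc v) xs)
    ≡⟨ ℕ∑.∑-distrib B (λ v → δ (f x) (suc v)) (λ v → count f (suc v) xs) ⟩
  ℕ∑.∑[ v < B ] δ (f x) (suc v) + ℕ∑.∑[ v < B ] count f (suc v) xs
    ≡⟨ cong₂ _+_ (∑-δ B 1≤fx fx≤B) (∑-count f B xs (range ∘ there)) ⟩
  suc (length xs) ∎
  where open ≡-Reasoning

compsF-fuel : ∀ {f f′} m → m ≤ f → m ≤ f′ → compsF f m ≡ compsF f′ m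
compsF-fuel zero _ _ = refl
compsF-fuel {suc f} {suc f′} (suc m) (s≤s m≤f) (s≤s m≤f′) =
  concatMap-cong tails-agree (upTo (suc m))
  where
  tails-agree : ∀ a → map (suc a ∷_) (compsF f (m ∸ a)) ≡ map (suc a ∷_) (compsF f′ (m ∸ a))
  tails-agree a = cong (map (suc a ∷_))
    (compsF-fuel (m ∸ a) (ℕₚ.≤-trans (ℕₚ.m∸n≤m m a) m≤f) (ℕₚ.≤-trans (ℕₚ.m∸n≤m m a) m≤f′))

compositions-suc : ∀ m →
  compositions (suc m) ≡ concatMap (λ a → map (suc a ∷_) (compositions (m ∸ a))) (upTo (suc m))
compositions-suc m = concatMap-cong
  (λ a → cong (map (suc a ∷_)) (compsF-fuel (m ∸ a) (ℕₚ.m∸n≤m m a) ℕₚ.≤-refl)) (upTo (suc m))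

sum-∈-compsF : ∀ f N {c} → c ∈ compsF f N → sum c ≡ N
sum-∈-compsF f       zero    (here refl) = refl
sum-∈-compsF (suc f) (suc m) c∈
  with a , a∈ , c∈tails ← find (∈-concatMap⁻ (λ a → map (suc a ∷_) (compsF f (m ∸ a)))
                                              {xs = upTo (suc m)} c∈)
  with c′ , c′∈ , refl ← ∈-map⁻ (suc a ∷_) c∈tails = begin
    suc a + sum c′   ≡⟨ cong (suc a ℕ.+_) (sum-∈-compsF f (m ∸ a) c′∈) ⟩
    suc a + (m ∸ a)  ≡⟨ cong suc (ℕₚ.m+[n∸m]≡n (ℕₚ.≤-pred (∈-upTo⁻ a∈))) ⟩
    suc m            ∎
  where open ≡-Reasoning

length-compositions-suc : ∀ m →
  length (compositions (suc m)) ≡ ℕ∑.∑[ a < suc m ] length (compositions (m ∸ a))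
length-compositions-suc m = begin
  length (compositions (suc m))
    ≡⟨ cong length (compositions-suc m) ⟩
  length (concatMap (λ a → map (suc a ∷_) (compositions (m ∸ a))) (upTo (suc m)))
    ≡⟨ length-concatMap (λ a → map (suc a ∷_) (compositions (m ∸ a))) (λ a → a) (suc m) ⟩
  ℕ∑.∑[ a < suc m ] length (map (suc a ∷_) (compositions (m ∸ a)))
    ≡⟨ ℕ∑.∑-cong (suc m) (λ a _ → length-map (suc a ∷_) (compositions (m ∸ a))) ⟩
  ℕ∑.∑[ a < suc m ] length (compositions (m ∸ a)) ∎
  where open ≡-Reasoning

length-compositions : ∀ m → length (compositions (suc m)) ≡ 2 ℕ.^ m
length-compositions zero    = refl
length-compositions (suc m) = begin
  length (compositions (suc (suc m)))
    ≡⟨ length-compositions-suc (suc m) ⟩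
  length (compositions (suc m)) + ℕ∑.∑[ a < suc m ] length (compositions (m ∸ a))
    ≡⟨ cong (length (compositions (suc m)) ℕ.+_) (sym (length-compositions-suc m)) ⟩
  length (compositions (suc m)) + length (compositions (suc m))
    ≡⟨ cong₂ _+_ (length-compositions m) (trans (length-compositions m) (sym (ℕₚ.+-identityʳ _))) ⟩
  2 ℕ.^ suc m ∎
  where open ≡-Reasoning

sumℤ-map-applyUpTo : ∀ (f : ℕ → ℤ) h n → sumℤ (map f (applyUpTo h n)) ≡ ℤ∑.∑[ i < n ] f (h i)
sumℤ-map-applyUpTo f h zero    = refl
sumℤ-map-applyUpTo f h (suc n) = cong (λ s → f (h 0) ℤ.+ s) (sumℤ-map-applyUpTo f (h ∘ suc) n)

pos-∑ : ∀ n (f : ℕ → ℕ) → + (ℕ∑.∑ n f) ≡ ℤ∑.∑[ i < n ] (+ f i)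
pos-∑ zero    f = refl
pos-∑ (suc n) f = trans (ℤₚ.pos-+ (f 0) _) (cong (λ s → + f 0 ℤ.+ s) (pos-∑ n (f ∘ suc)))

*-distribˡ-∑ : ∀ c n (f : ℕ → ℤ) → c * ℤ∑.∑ n f ≡ ℤ∑.∑[ i < n ] (c * f i)
*-distribˡ-∑ c zero    f = ℤₚ.*-zeroʳ c
*-distribˡ-∑ c (suc n) f =
  trans (ℤₚ.*-distribˡ-+ c (f 0) _) (cong (λ s → c * f 0 ℤ.+ s) (*-distribˡ-∑ c n (f ∘ suc)))

*-distribʳ-∑ : ∀ c n (f : ℕ → ℤ) → ℤ∑.∑ n f * c ≡ ℤ∑.∑[ i < n ] (f i * c)
*-distribʳ-∑ c n f = trans (ℤₚ.*-comm _ c)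
  (trans (*-distribˡ-∑ c n f) (ℤ∑.∑-cong n (λ i _ → ℤₚ.*-comm c (f i))))

gcdList-∣-sum : ∀ c → gcdList c ∣ sum c
gcdList-∣-sum []      = ∣-refl
gcdList-∣-sum (a ∷ c) =
  ∣m∣n⇒∣m+n (gcd[m,n]∣m a (gcdList c)) (∣-trans (gcd[m,n]∣n a (gcdList c)) (gcdList-∣-sum c))

∈-compositions⇒gcd∣gcd : ∀ x {N c} → c ∈ compositions N → gcd x (gcdList c) ∣ gcd x N
∈-compositions⇒gcd∣gcd x {N} {c} c∈ = gcd-greatest (gcd[m,n]∣m x (gcdList c))
  (∣-trans (gcd[m,n]∣n x (gcdList c)) (subst (gcdList c ∣_) (sum-∈-compsF N N c∈) (gcdList-∣-sum c)))

-- x is the gcd of the parts already split off; carrying it is what makes countGcd-suc hold.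
countGcd : ℕ → ℕ → ℕ → ℕ
countGcd x g N = count (λ c → gcd x (gcdList c)) g (compositions N)

countGcd-zero : ∀ x g → countGcd x g 0 ≡ δ x g
countGcd-zero x g = trans (count-∷ (λ c → gcd x (gcdList c)) g [] [])
  (trans (ℕₚ.+-identityʳ _) (cong (λ y → δ y g) (gcd-identityʳ x)))

countGcd-suc : ∀ x g m →
  countGcd x g (suc m) ≡ ℕ∑.∑[ a < suc m ] countGcd (gcd x (suc a)) g (m ∸ a)
countGcd-suc x g m = begin
  count F g (compositions (suc m))
    ≡⟨ cong (count F g) (compositions-suc m) ⟩
  count F g (concatMap tails (upTo (suc m)))
    ≡⟨ count-concatMap F g tails (λ a → a) (suc m) ⟩
  ℕ∑.∑[ a < suc m ] count F g (map (suc a ∷_) (compositions (m ∸ a)))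
    ≡⟨ ℕ∑.∑-cong (suc m) (λ a _ → trans (count-map F g (suc a ∷_) (compositions (m ∸ a)))
         (count-cong g (compositions (m ∸ a)) (λ c → sym (gcd-assoc x (suc a) (gcdList c))))) ⟩
  ℕ∑.∑[ a < suc m ] countGcd (gcd x (suc a)) g (m ∸ a) ∎
  where
  open ≡-Reasoning
  F : List ℕ → ℕ
  F c = gcd x (gcdList c)
  tails : ℕ → List (List ℕ)
  tails a = map (suc a ∷_) (compositions (m ∸ a))

countGcd-vanish : ∀ x {g} N → g ∤ gcd x N → countGcd x g N ≡ 0
countGcd-vanish x {g} N g∤ = count-none _ g (compositions N)
  (λ c∈ gcd≡g → g∤ (subst (_∣ gcd x N) gcd≡g (∈-compositions⇒gcd∣gcd x c∈)))

∑-countGcd : ∀ x N B → 1 ≤ gcd x N → gcd x N ≤ B →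
             ℕ∑.∑[ j < B ] countGcd x (suc j) N ≡ length (compositions N)
∑-countGcd x N B 1≤G G≤B = ∑-count _ B (compositions N) bounds
  where
  bounds : ∀ {c} → c ∈ compositions N → 1 ≤ gcd x (gcdList c) × gcd x (gcdList c) ≤ B
  bounds {c} c∈ = ℕₚ.n≢0⇒n>0 (λ d≡0 → ℕₚ.<⇒≢ 1≤G (sym (0∣⇒≡0 (subst (_∣ gcd x N) d≡0 d∣G))))
                , ℕₚ.≤-trans (∣⇒≤ {{>-nonZero 1≤G}} d∣G) G≤B
    where
    d∣G : gcd x (gcdList c) ∣ gcd x N
    d∣G = ∈-compositions⇒gcd∣gcd x c∈

countGcd-scale : ∀ k .{{_ : NonZero k}} N x g →
                 countGcd (x ℕ.* k) (g ℕ.* k) (N ℕ.* k) ≡ countGcd x g N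
countGcd-scale k@(suc k′) = <-rec Scales scale
  where
  Scales : ℕ → Set
  Scales N = ∀ x g → countGcd (x ℕ.* k) (g ℕ.* k) (N ℕ.* k) ≡ countGcd x g N

  gcd-*ʳ : ∀ m n → gcd (m ℕ.* k) (n ℕ.* k) ≡ gcd m n ℕ.* k
  gcd-*ʳ m n = begin
    gcd (m ℕ.* k) (n ℕ.* k) ≡⟨ cong₂ gcd (ℕₚ.*-comm m k) (ℕₚ.*-comm n k) ⟩
    gcd (k ℕ.* m) (k ℕ.* n) ≡⟨ sym (c*gcd[m,n]≡gcd[cm,cn] k m n) ⟩
    k ℕ.* gcd m n           ≡⟨ ℕₚ.*-comm k (gcd m n) ⟩
    gcd m n ℕ.* k           ∎
    where open ≡-Reasoning

  scale : ∀ N → (∀ {M} → M < N → Scales M) → Scales N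
  scale zero    _   x g = begin
    countGcd (x ℕ.* k) (g ℕ.* k) 0 ≡⟨ countGcd-zero (x ℕ.* k) (g ℕ.* k) ⟩
    δ (x ℕ.* k) (g ℕ.* k)          ≡⟨ δ-*ʳ x g k ⟩
    δ x g                          ≡⟨ sym (countGcd-zero x g) ⟩
    countGcd x g 0                 ∎
    where open ≡-Reasoning
  scale (suc m) rec x g = begin
    countGcd (x ℕ.* k) (g ℕ.* k) (suc m ℕ.* k)
      ≡⟨ countGcd-suc (x ℕ.* k) (g ℕ.* k) (k′ + m ℕ.* k) ⟩
    ℕ∑.∑[ t < suc m ℕ.* k ] F (suc t)
      ≡⟨ ℕ∑.∑-multiples (suc m) k F F-vanishes ⟩
    ℕ∑.∑[ b < suc m ] F (suc b ℕ.* k)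
      ≡⟨ ℕ∑.∑-cong (suc m) (λ b _ → F-multiple b) ⟩
    ℕ∑.∑[ b < suc m ] countGcd (gcd x (suc b)) g (m ∸ b)
      ≡⟨ sym (countGcd-suc x g m) ⟩
    countGcd x g (suc m) ∎
    where
    open ≡-Reasoning
    F : ℕ → ℕ
    F n = countGcd (gcd (x ℕ.* k) n) (g ℕ.* k) (suc m ℕ.* k ∸ n)
    F-multiple : ∀ b → F (suc b ℕ.* k) ≡ countGcd (gcd x (suc b)) g (m ∸ b)
    F-multiple b = begin
      countGcd (gcd (x ℕ.* k) (suc b ℕ.* k)) (g ℕ.* k) (suc m ℕ.* k ∸ suc b ℕ.* k)
        ≡⟨ cong₂ (λ y M → countGcd y (g ℕ.* k) M)
                 (gcd-*ʳ x (suc b)) (sym (ℕₚ.*-distribʳ-∸ k (suc m) (suc b))) ⟩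
      countGcd (gcd x (suc b) ℕ.* k) (g ℕ.* k) ((m ∸ b) ℕ.* k)
        ≡⟨ rec (s≤s (ℕₚ.m∸n≤m m b)) (gcd x (suc b)) g ⟩
      countGcd (gcd x (suc b)) g (m ∸ b) ∎
    F-vanishes : ∀ n → k ∤ n → F n ≡ 0
    F-vanishes n k∤n = countGcd-vanish (gcd (x ℕ.* k) n) (suc m ℕ.* k ∸ n)
      (λ gk∣ → k∤n (∣-trans (n∣m*n g)
        (∣-trans gk∣ (∣-trans (gcd[m,n]∣m _ _) (gcd[m,n]∣n (x ℕ.* k) n)))))

cψ≡countGcd : ∀ m → cψ m ≡ countGcd 0 1 m
cψ≡countGcd m = count-cong 1 (compositions m) (λ c → sym (gcd-identityˡ (gcdList c)))

countGcd-multiple : ∀ g .{{_ : NonZero g}} m → countGcd 0 g (m ℕ.* g) ≡ cψ m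
countGcd-multiple g m = begin
  countGcd 0 g (m ℕ.* g)
    ≡⟨ cong (λ y → countGcd 0 y (m ℕ.* g)) (sym (ℕₚ.*-identityˡ g)) ⟩
  countGcd (0 ℕ.* g) (1 ℕ.* g) (m ℕ.* g)
    ≡⟨ countGcd-scale g m 0 1 ⟩
  countGcd 0 1 m
    ≡⟨ sym (cψ≡countGcd m) ⟩
  cψ m ∎
  where open ≡-Reasoning

pow2≡∑-countGcd : ∀ {n t} → t < n → + (2 ℕ.^ t) ≡ ℤ∑.∑[ j < n ] (+ countGcd 0 (suc j) (suc t))
pow2≡∑-countGcd {n} {t} t<n = begin
  + (2 ℕ.^ t)                                    ≡⟨ cong +_ (sym (length-compositions t)) ⟩
  + length (compositions (suc t))                ≡⟨ cong +_ (sym (∑-countGcd 0 (suc t) n (s≤s z≤n) t<n)) ⟩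
  + (ℕ∑.∑[ j < n ] countGcd 0 (suc j) (suc t))   ≡⟨ pos-∑ n (λ j → countGcd 0 (suc j) (suc t)) ⟩
  ℤ∑.∑[ j < n ] (+ countGcd 0 (suc j) (suc t))   ∎
  where open ≡-Reasoning

ω-beyond : ∀ {n N} → n < N → ω (+ n - + N) ≡ 0ℤ
ω-beyond {n} {N} n<N = begin
  ω (+ n - + N)      ≡⟨ cong ω (ℤₚ.[+m]-[+n]≡m⊖n n N) ⟩
  ω (n ⊖ N)          ≡⟨ cong ω (ℤₚ.⊖-< n<N) ⟩
  ω (ℤ.- + (N ∸ n))  ≡⟨ ω-neg (ℕₚ.m<n⇒0<n∸m n<N) ⟩
  0ℤ                 ∎
  where
  open ≡-Reasoning
  ω-neg : ∀ {k} → 0 < k → ω (ℤ.- + k) ≡ 0ℤ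
  ω-neg {suc _} _ = refl

[n∸m]-x≡n-[m+x] : ∀ {m n} x → m ≤ n → + (n ∸ m) - + x ≡ + n - + (m + x)
[n∸m]-x≡n-[m+x] {m} {n} x m≤n = begin
  + (n ∸ m) - + x         ≡⟨ ℤₚ.[+m]-[+n]≡m⊖n (n ∸ m) x ⟩
  (n ∸ m) ⊖ x             ≡⟨ sym (ℤₚ.+-cancelˡ-⊖ m (n ∸ m) x) ⟩
  (m + (n ∸ m)) ⊖ (m + x) ≡⟨ cong (_⊖ (m + x)) (ℕₚ.m+[n∸m]≡n m≤n) ⟩
  n ⊖ (m + x)             ≡⟨ sym (ℤₚ.[+m]-[+n]≡m⊖n n (m + x)) ⟩
  + n - + (m + x)         ∎
  where open ≡-Reasoning

n<[1+j]*m : ∀ {n} m j .{{_ : NonZero m}} → m ≤ n → n ∸ m < j → n < suc j ℕ.* m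
n<[1+j]*m {n} m j m≤n n∸m<j = begin-strict
  n             ≡⟨ ℕₚ.m+[n∸m]≡n m≤n ⟨
  m + (n ∸ m)   <⟨ ℕₚ.+-monoʳ-< m n∸m<j ⟩
  m + j         ≤⟨ ℕₚ.+-monoʳ-≤ m (ℕₚ.m≤m*n j m) ⟩
  m + j ℕ.* m   ∎
  where open ℕₚ.≤-Reasoning

Σ-multiples : ∀ {n} m .{{_ : NonZero m}} → m ≤ n →
  Σ[ 0 ≤ (n ∸ m) ≤ (λ j → ω (+ (n ∸ m) - + (j ℕ.* m))) ] ≡ ℤ∑.∑[ j < n ] ω (+ n - + (m ℕ.* suc j))
Σ-multiples {n} m m≤n = begin
  Σ[ 0 ≤ (n ∸ m) ≤ (λ j → ω (+ (n ∸ m) - + (j ℕ.* m))) ]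
    ≡⟨ sumℤ-map-applyUpTo (λ j → ω (+ (n ∸ m) - + (j ℕ.* m))) (λ j → j) (suc (n ∸ m)) ⟩
  ℤ∑.∑[ j < suc (n ∸ m) ] ω (+ (n ∸ m) - + (j ℕ.* m))
    ≡⟨ ℤ∑.∑-cong (suc (n ∸ m)) (λ j _ → cong ω ([n∸m]-x≡n-[m+x] (j ℕ.* m) m≤n)) ⟩
  ℤ∑.∑[ j < suc (n ∸ m) ] ω (+ n - + (suc j ℕ.* m))
    ≡⟨ sym (ℤ∑.∑-extend n∸m<n (λ j n∸m<j _ → ω-beyond (n<[1+j]*m m j m≤n n∸m<j))) ⟩
  ℤ∑.∑[ j < n ] ω (+ n - + (suc j ℕ.* m))
    ≡⟨ ℤ∑.∑-cong n (λ j _ → cong (λ N → ω (+ n - + N)) (ℕₚ.*-comm (suc j) m)) ⟩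
  ℤ∑.∑[ j < n ] ω (+ n - + (m ℕ.* suc j)) ∎
  where
  open ≡-Reasoning
  n∸m<n : n ∸ m < n
  n∸m<n = ℕₚ.∸-monoʳ-< (ℕ.>-nonZero⁻¹ m) m≤n

∑-countGcd-reindex : ∀ n g .{{_ : NonZero g}} (w : ℕ → ℤ) → (∀ N → n < N → w N ≡ 0ℤ) →
  ℤ∑.∑[ t < n ] (+ countGcd 0 g (suc t) * w (suc t)) ≡ ℤ∑.∑[ b < n ] (+ cψ (suc b) * w (suc b ℕ.* g))
∑-countGcd-reindex n g w w-beyond = begin
  ℤ∑.∑[ t < n ] F (suc t)
    ≡⟨ ℤ∑.∑-multiples-bounded n g F F-off-multiples F-beyond ⟩
  ℤ∑.∑[ b < n ] F (suc b ℕ.* g)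
    ≡⟨ ℤ∑.∑-cong n (λ b _ → cong (λ c → + c * w (suc b ℕ.* g)) (countGcd-multiple g (suc b))) ⟩
  ℤ∑.∑[ b < n ] (+ cψ (suc b) * w (suc b ℕ.* g)) ∎
  where
  open ≡-Reasoning
  F : ℕ → ℤ
  F N = + countGcd 0 g N * w N
  F-off-multiples : ∀ N → g ∤ N → F N ≡ 0ℤ
  F-off-multiples N g∤N =
    cong (λ c → + c * w N) (countGcd-vanish 0 N (g∤N ∘ subst (g ∣_) (gcd-identityˡ N)))
  F-beyond : ∀ N → n < N → F N ≡ 0ℤ
  F-beyond N n<N =
    trans (cong (+ countGcd 0 g N *_) (w-beyond N n<N)) (ℤₚ.*-zeroʳ (+ countGcd 0 g N))

-- For n = 0 both sides are empty sums.
mainTheorem14 : (n : ℕ) → 1 ℕ.≤ n →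
    Σ[ 1 ≤ n ≤ (λ k → (+ (2 ℕ.^ (k ∸ 1))) * ω (+ n - + k)) ]
      ≡ Σ[ 1 ≤ n ≤ (λ m → (+ cψ m) * Σ[ 0 ≤ (n ∸ m) ≤ (λ j → ω (+ (n ∸ m) - + (j ℕ.* m))) ]) ]
mainTheorem14 n _ = begin
  Σ[ 1 ≤ n ≤ (λ k → (+ (2 ℕ.^ (k ∸ 1))) * ω (+ n - + k)) ]
    ≡⟨ sumℤ-map-applyUpTo (λ t → + (2 ℕ.^ t) * w (suc t)) (λ t → t) n ⟩
  ℤ∑.∑[ t < n ] (+ (2 ℕ.^ t) * w (suc t))
    ≡⟨ ℤ∑.∑-cong n (λ t t<n → trans (cong (_* w (suc t)) (pow2≡∑-countGcd t<n))
                                     (*-distribʳ-∑ (w (suc t)) n (λ j → + countGcd 0 (suc j) (suc t)))) ⟩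
  ℤ∑.∑[ t < n ] ℤ∑.∑[ j < n ] (+ countGcd 0 (suc j) (suc t) * w (suc t))
    ≡⟨ ℤ∑.∑-comm n n (λ t j → + countGcd 0 (suc j) (suc t) * w (suc t)) ⟩
  ℤ∑.∑[ j < n ] ℤ∑.∑[ t < n ] (+ countGcd 0 (suc j) (suc t) * w (suc t))
    ≡⟨ ℤ∑.∑-cong n (λ j _ → ∑-countGcd-reindex n (suc j) w (λ _ → ω-beyond)) ⟩
  ℤ∑.∑[ j < n ] ℤ∑.∑[ b < n ] (+ cψ (suc b) * w (suc b ℕ.* suc j))
    ≡⟨ ℤ∑.∑-comm n n (λ j b → + cψ (suc b) * w (suc b ℕ.* suc j)) ⟩
  ℤ∑.∑[ b < n ] ℤ∑.∑[ j < n ] (+ cψ (suc b) * w (suc b ℕ.* suc j))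
    ≡⟨ ℤ∑.∑-cong n (λ b b<n → trans (sym (*-distribˡ-∑ (+ cψ (suc b)) n (λ j → w (suc b ℕ.* suc j))))
                                     (cong (+ cψ (suc b) *_) (sym (Σ-multiples (suc b) b<n)))) ⟩
  ℤ∑.∑[ b < n ] rhs-term (suc b)
    ≡⟨ sumℤ-map-applyUpTo (λ b → rhs-term (suc b)) (λ b → b) n ⟨
  Σ[ 1 ≤ n ≤ rhs-term ] ∎
  where
  open ≡-Reasoning
  w : ℕ → ℤ
  w N = ω (+ n - + N)
  rhs-term : ℕ → ℤ
  rhs-term m = + cψ m * Σ[ 0 ≤ (n ∸ m) ≤ (λ j → ω (+ (n ∸ m) - + (j ℕ.* m))) ]
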